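{- Each of the rules scut and ccut of the skew monoidal sequent calculus is eliminable: given cut-free derivations of its premises, there is a cut-free derivation of its conclusion. That is, (i) from cut-free derivations of $S \mid \Gamma \vdash A$ and $A \mid \Delta \vdash C$ one obtains a cut-free derivation of $S \mid \Gamma, \Delta \vdash C$, and (ii) from cut-free derivations of $- \mid \Gamma \vdash A$ and $S \mid \Delta_0, A, \Delta_1 \vdash C$ one obtains a cut-free derivation of $S \mid \Delta_0, \Gamma, \Delta_1 \vdash C$.
   Context: Fix a set $\mathrm{Var}$ of atoms. Formulae are generated by: every atom $X \in \mathrm{Var}$ is a formula; $\mathsf{I}$ is a formula; if $A, B$ are formulae then so is $A \otimes B$. A context $\Gamma$ is a finite list of formulae; a stoup $S$ is either empty (written $-$) or a single formula. The skew monoidal sequent calculus derives sequents $S \mid \Gamma \vdash C$ by the rules: (ax) $A \mid\ \vdash A$; (pass) from $A \mid \Gamma \vdash C$ infer $- \mid A, \Gamma \vdash C$; (scut) from $S \mid \Gamma \vdash A$ and $A \mid \Delta \vdash C$ infer $S \mid \Gamma, \Delta \vdash C$; (ccut) from $- \mid \Gamma \vdash A$ and $S \mid \Delta_0, A, \Delta_1 \vdash C$ infer $S \mid \Delta_0, \Gamma, \Delta_1 \vdash C$; ($\mathsf{I}$L) from $- \mid \Gamma \vdash C$ infer $\mathsf{I} \mid \Gamma \vdash C$; ($\mathsf{I}$R) $- \mid\ \vdash \mathsf{I}$; ($\otimes$L) from $A \mid B, \Gamma \vdash C$ infer $A \otimes B \mid \Gamma \vdash C$; ($\otimes$R) from $S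 \mid \Gamma \vdash A$ and $- \mid \Delta \vdash B$ infer $S \mid \Gamma, \Delta \vdash A \otimes B$. A derivation is cut-free if it uses neither scut nor ccut. -}

module Defs where

open import Data.List using (List; []; _∷_; _++_)
open import Data.Maybe using (Maybe; just; nothing)
open import Data.Unit using (⊤; tt)
open import Data.Empty using (⊥)
open import Data.Product using (_×_)

module Skew (Var : Set) where

  data Fma : Set where
    ` : Var → Fma
    I : Fma
    _⊗_ : Fma → Fma → Fma

  Cxt : Set
  Cxt = List Fma

  -- A stoup is either empty (nothing, written -) or a single formula.
  Stp : Set
  Stp = Maybe Fma

  infix 15 _∣_⊢_
  data _∣_⊢_ : Stp → Cxt → Fma → Set where
    ax   : {A : Fma} → just A ∣ [] ⊢ A
    pass : {Γ : Cxt} {A C : Fma} → just A ∣ Γ ⊢ C → nothing ∣ A ∷ Γ ⊢ C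
    scut : {S : Stp} {Γ Δ : Cxt} {A C : Fma} →
           S ∣ Γ ⊢ A → just A ∣ Δ ⊢ C → S ∣ Γ ++ Δ ⊢ C
    ccut : {S : Stp} {Γ Δ₀ Δ₁ : Cxt} {A C : Fma} →
           nothing ∣ Γ ⊢ A → S ∣ Δ₀ ++ A ∷ Δ₁ ⊢ C → S ∣ Δ₀ ++ Γ ++ Δ₁ ⊢ C
    IL   : {Γ : Cxt} {C : Fma} → nothing ∣ Γ ⊢ C → just I ∣ Γ ⊢ C
    IR   : nothing ∣ [] ⊢ I
    ⊗L   : {Γ : Cxt} {A B C : Fma} → just A ∣ B ∷ Γ ⊢ C → just (A ⊗ B) ∣ Γ ⊢ C
    ⊗R   : {S : Stp} {Γ Δ : Cxt} {A B : Fma} →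
           S ∣ Γ ⊢ A → nothing ∣ Δ ⊢ B → S ∣ Γ ++ Δ ⊢ A ⊗ B

  CutFree : {S : Stp} {Γ : Cxt} {C : Fma} → S ∣ Γ ⊢ C → Set
  CutFree ax = ⊤
  CutFree (pass f) = CutFree f
  CutFree (scut f g) = ⊥
  CutFree (ccut f g) = ⊥
  CutFree (IL f) = CutFree f
  CutFree IR = ⊤
  CutFree (⊗L f) = CutFree f
  CutFree (⊗R f g) = CutFree f × CutFree g

{-# OPTIONS --safe #-}
module Submission where

-- The cut scut is pushed up the
-- left premise until that ends in IR or ⊗R; it is then pushed up the right premise
-- until the cut formula is principal there, and the principal case ⊗R/⊗L becomes an
-- scut on A followed by a ccut on B.  The cut ccut is pushed up its right premise
-- until the cut formula is passed into the stoup, where it becomes an scut.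

open import Defs
open import Data.List using (List; []; _∷_; _++_)
open import Data.List.Properties using (++-assoc; ++-identityʳ; ∷-injective)
open import Data.Maybe using (just; nothing)
open import Data.Product using (Σ; _×_; _,_)
open import Data.Unit using (tt)
open import Relation.Binary.PropositionalEquality using (_≡_; refl; sym; trans; cong; subst)

module _ {X : Set} where

  data ++-∷-Split (Γ₁ Γ₂ Δ₀ : List X) (A : X) (Δ₁ : List X) : Set where
    inLeft  : (Ξ : List X) → Γ₁ ≡ Δ₀ ++ A ∷ Ξ → Δ₁ ≡ Ξ ++ Γ₂ → ++-∷-Split Γ₁ Γ₂ Δ₀ A Δ₁
    inRight : (Ξ : List X) → Δ₀ ≡ Γ₁ ++ Ξ → Γ₂ ≡ Ξ ++ A ∷ Δ₁ → ++-∷-Split Γ₁ Γ₂ Δ₀ A Δ₁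

  ++-∷-split : (Γ₁ Γ₂ Δ₀ : List X) {A : X} {Δ₁ : List X} →
               Γ₁ ++ Γ₂ ≡ Δ₀ ++ A ∷ Δ₁ → ++-∷-Split Γ₁ Γ₂ Δ₀ A Δ₁
  ++-∷-split []       Γ₂ Δ₀       eq   = inRight Δ₀ refl eq
  ++-∷-split (x ∷ Γ₁) Γ₂ []       refl = inLeft Γ₁ refl refl
  ++-∷-split (x ∷ Γ₁) Γ₂ (y ∷ Δ₀) eq with ∷-injective eq
  ... | refl , eq′ with ++-∷-split Γ₁ Γ₂ Δ₀ eq′
  ...   | inLeft  Ξ p q = inLeft  Ξ (cong (x ∷_) p) q
  ...   | inRight Ξ p q = inRight Ξ (cong (x ∷_) p) q

module CutElimination (Var : Set) where
  open Skew Var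

  infix 15 _∣_⊢ᶠ_
  data _∣_⊢ᶠ_ : Stp → Cxt → Fma → Set where
    ax   : {A : Fma} → just A ∣ [] ⊢ᶠ A
    pass : {Γ : Cxt} {A C : Fma} → just A ∣ Γ ⊢ᶠ C → nothing ∣ A ∷ Γ ⊢ᶠ C
    IL   : {Γ : Cxt} {C : Fma} → nothing ∣ Γ ⊢ᶠ C → just I ∣ Γ ⊢ᶠ C
    IR   : nothing ∣ [] ⊢ᶠ I
    ⊗L   : {Γ : Cxt} {A B C : Fma} → just A ∣ B ∷ Γ ⊢ᶠ C → just (A ⊗ B) ∣ Γ ⊢ᶠ C
    ⊗R   : {S : Stp} {Γ Δ : Cxt} {A B : Fma} →
           S ∣ Γ ⊢ᶠ A → nothing ∣ Δ ⊢ᶠ B → S ∣ Γ ++ Δ ⊢ᶠ A ⊗ B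

  toCutFree : {S : Stp} {Γ : Cxt} {C : Fma} (f : S ∣ Γ ⊢ C) → CutFree f → S ∣ Γ ⊢ᶠ C
  toCutFree ax       _       = ax
  toCutFree (pass f) cf      = pass (toCutFree f cf)
  toCutFree (IL f)   cf      = IL (toCutFree f cf)
  toCutFree IR       _       = IR
  toCutFree (⊗L f)   cf      = ⊗L (toCutFree f cf)
  toCutFree (⊗R f g) (cf , cg) = ⊗R (toCutFree f cf) (toCutFree g cg)

  fromCutFree : {S : Stp} {Γ : Cxt} {C : Fma} → S ∣ Γ ⊢ᶠ C → Σ (S ∣ Γ ⊢ C) CutFree
  fromCutFree ax       = ax , tt
  fromCutFree (pass f) with fromCutFree f
  ... | f′ , cf = pass f′ , cf
  fromCutFree (IL f) with fromCutFree f
  ... | f′ , cf = IL f′ , cf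
  fromCutFree IR       = IR , tt
  fromCutFree (⊗L f) with fromCutFree f
  ... | f′ , cf = ⊗L f′ , cf
  fromCutFree (⊗R f g) with fromCutFree f | fromCutFree g
  ... | f′ , cf | g′ , cg = ⊗R f′ g′ , (cf , cg)

  cast : {S : Stp} {Γ Γ′ : Cxt} {C : Fma} → Γ ≡ Γ′ → S ∣ Γ ⊢ᶠ C → S ∣ Γ′ ⊢ᶠ C
  cast {S} {C = C} = subst (λ Γ → S ∣ Γ ⊢ᶠ C)

  mutual
    scutᶠ : {S : Stp} {Γ Δ : Cxt} {A C : Fma} →
            S ∣ Γ ⊢ᶠ A → just A ∣ Δ ⊢ᶠ C → S ∣ Γ ++ Δ ⊢ᶠ C
    scutᶠ ax       g        = g
    scutᶠ (pass f) g        = pass (scutᶠ f g)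
    scutᶠ (IL f)   g        = IL (scutᶠ f g)
    scutᶠ (⊗L f)   g        = ⊗L (scutᶠ f g)
    scutᶠ IR       ax       = IR
    scutᶠ IR       (IL g)   = g
    scutᶠ IR       (⊗R g h) = ⊗R (scutᶠ IR g) h
    scutᶠ (⊗R f h) ax       = cast (sym (++-identityʳ _)) (⊗R f h)
    scutᶠ (⊗R {Γ = Γ₁} {Δ = Γ₂} f h) (⊗L {Γ = Δ} g) =
      cast (sym (++-assoc Γ₁ Γ₂ Δ)) (scutᶠ f (ccutᶠ [] h g refl))
    scutᶠ {Γ = Γ} (⊗R f h) (⊗R {Γ = Δ₁} {Δ = Δ₂} g k) =
      cast (++-assoc Γ Δ₁ Δ₂) (⊗R (scutᶠ (⊗R f h) g) k)

    -- The equation Δ ≡ Δ₀ ++ A ∷ Δ₁ keeps the right premise's context a variable,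
    -- so that its ⊗R case can be matched and then split with ++-∷-split.
    ccutᶠ : {S : Stp} {Γ Δ Δ₁ : Cxt} {A C : Fma} (Δ₀ : Cxt) →
            nothing ∣ Γ ⊢ᶠ A → S ∣ Δ ⊢ᶠ C → Δ ≡ Δ₀ ++ A ∷ Δ₁ → S ∣ Δ₀ ++ Γ ++ Δ₁ ⊢ᶠ C
    ccutᶠ []      f ax       ()
    ccutᶠ (_ ∷ _) f ax       ()
    ccutᶠ []      f IR       ()
    ccutᶠ (_ ∷ _) f IR       ()
    ccutᶠ []      f (pass g) refl = scutᶠ f g
    ccutᶠ (_ ∷ Δ₀) f (pass g) refl = pass (ccutᶠ Δ₀ f g refl)
    ccutᶠ Δ₀ f (IL g) eq = IL (ccutᶠ Δ₀ f g eq)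
    ccutᶠ Δ₀ f (⊗L {B = B} g) eq = ⊗L (ccutᶠ (B ∷ Δ₀) f g (cong (B ∷_) eq))
    ccutᶠ {Γ = Γ} {Δ₁ = Δ₁} Δ₀ f (⊗R {Γ = Γ₁} {Δ = Γ₂} g h) eq
      with ++-∷-split Γ₁ Γ₂ Δ₀ eq
    ... | inLeft Ξ refl refl =
      cast (trans (++-assoc (Δ₀ ++ Γ) Ξ Γ₂) (++-assoc Δ₀ Γ (Ξ ++ Γ₂)))
        (⊗R (cast (sym (++-assoc Δ₀ Γ Ξ)) (ccutᶠ Δ₀ f g refl)) h)
    ... | inRight Ξ refl refl =
      cast (sym (++-assoc Γ₁ Ξ (Γ ++ Δ₁))) (⊗R g (ccutᶠ Ξ f h refl))

lemma4p1 : (Var : Set) → let open Skew Var in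
    ((S : Stp) (Γ Δ : Cxt) (A C : Fma)
      (f : S ∣ Γ ⊢ A) (g : just A ∣ Δ ⊢ C) → CutFree f → CutFree g →
      Σ (S ∣ Γ ++ Δ ⊢ C) CutFree)
    ×
    ((S : Stp) (Γ Δ₀ Δ₁ : Cxt) (A C : Fma)
      (f : nothing ∣ Γ ⊢ A) (g : S ∣ Δ₀ ++ A ∷ Δ₁ ⊢ C) → CutFree f → CutFree g →
      Σ (S ∣ Δ₀ ++ Γ ++ Δ₁ ⊢ C) CutFree)
lemma4p1 Var =
  (λ S Γ Δ A C f g cf cg → fromCutFree (scutᶠ (toCutFree f cf) (toCutFree g cg))) ,
  (λ S Γ Δ₀ Δ₁ A C f g cf cg → fromCutFree (ccutᶠ Δ₀ (toCutFree f cf) (toCutFree g cg) refl))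
  where open CutElimination Var
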